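{- If $G=(X,Y;E)$ is a bipartite graph, then $\chi'_{int}(G,X) \leq \Delta(X)\,\check s(G)$.
   Context: For a bipartite graph $G$ with parts $X$ and $Y$, an $X$-interval coloring is a proper edge coloring of $G$ by integers such that, for every vertex $x\in X$, the set of colors on the edges incident to $x$ forms an interval of consecutive integers; $\chi'_{int}(G,X)$ is the smallest number of colors in an $X$-interval coloring of $G$. $\Delta(X)$ is the maximum degree of the vertices in $X$. For a proper edge coloring $\varphi$ and a vertex $v$, the palette of $v$ is the set of colors on edges incident to $v$; the palette index $\check s(G)$ is the minimum number of distinct palettes occurring in a proper edge coloring of $G$. -}

module Defs where

open import Data.Nat using (ℕ; _≤_; _⊔_; _*_)
open import Data.Bool using (Bool; true; T)
open import Data.Fin using (Fin)
open import Data.List using (List; length; filter; map; foldr; allFin)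
open import Data.List.Membership.Propositional using (_∈_)
open import Data.Product using (Σ; ∃; _×_; _,_)
open import Data.Sum using (_⊎_; inj₁; inj₂)
open import Relation.Binary.PropositionalEquality using (_≡_)
open import Relation.Nullary.Decidable using (T?)
open import Function.Bundles using (_⇔_)

-- A (finite, simple) bipartite graph G = (X, Y; E) with X = Fin m, Y = Fin n;
-- adj x y = true iff xy ∈ E.
record BipGraph : Set where
  field
    m n : ℕ
    adj : Fin m → Fin n → Bool
open BipGraph public

Vertex : BipGraph → Set
Vertex G = Fin (m G) ⊎ Fin (n G)

-- An edge colouring by (natural number) colours; only values on edges matter.
Colouring : BipGraph → Set
Colouring G = Fin (m G) → Fin (n G) → ℕ

Proper : (G : BipGraph) → Colouring G → Set
Proper G col =
  (∀ x y y′ → adj G x y ≡ true → adj G x y′ ≡ true → col x y ≡ col x y′ → y ≡ y′)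
  × (∀ x x′ y → adj G x y ≡ true → adj G x′ y ≡ true → col x y ≡ col x′ y → x ≡ x′)

InPalette : (G : BipGraph) → Colouring G → Vertex G → ℕ → Set
InPalette G col (inj₁ x) c = ∃ λ y → adj G x y ≡ true × col x y ≡ c
InPalette G col (inj₂ y) c = ∃ λ x → adj G x y ≡ true × col x y ≡ c

SamePalette : (G : BipGraph) → Colouring G → Vertex G → Vertex G → Set
SamePalette G col v w = ∀ c → InPalette G col v c ⇔ InPalette G col w c

AtMostPalettes : (G : BipGraph) → Colouring G → ℕ → Set
AtMostPalettes G col k =
  Σ (Vertex G → Fin k) λ lab → ∀ v w → lab v ≡ lab w → SamePalette G col v w

IsPaletteIndex : BipGraph → ℕ → Set
IsPaletteIndex G s =
  (Σ (Colouring G) λ col → Proper G col × AtMostPalettes G col s)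
  × (∀ k → (Σ (Colouring G) λ col → Proper G col × AtMostPalettes G col k) → s ≤ k)

XInterval : (G : BipGraph) → Colouring G → Set
XInterval G col = ∀ x → Σ ℕ λ a → Σ ℕ λ b →
  ∀ c → InPalette G col (inj₁ x) c ⇔ (a ≤ c × c ≤ b)

AtMostColours : (G : BipGraph) → Colouring G → ℕ → Set
AtMostColours G col k =
  Σ (List ℕ) λ L → length L ≤ k × (∀ x y → adj G x y ≡ true → col x y ∈ L)

degX : (G : BipGraph) → Fin (m G) → ℕ
degX G x = length (filter (λ y → T? (adj G x y)) (allFin (n G)))

-- Δ(X): maximum degree of the vertices of X (0 if X is empty)
ΔX : BipGraph → ℕ
ΔX G = foldr _⊔_ 0 (map (degX G) (allFin (m G)))

-- Fix a proper colouring whose X-vertices use at most s palettes, labelled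
-- i < s.  Recolour an edge xy by 1 + Δ·i + r, where i is the label of x's
-- palette and r is the rank of the old colour of xy within that palette.
-- Each x then sees exactly the consecutive colours Δ·i + 1, …, Δ·i + |palette|,
-- all colours lie in 1 … Δ·s, and the new colouring stays proper at Y:
-- equal new colours at y force equal labels, hence equal palettes, hence equal
-- ranks, hence equal old colours.
module Submission where

open import Defs
open import Data.Bool using (true; T)
import Data.Bool as Bool
open import Data.Empty using (⊥-elim)
open import Data.Fin using (Fin; toℕ)
import Data.Fin.Properties as Fin
open import Data.List using (List; []; _∷_; length; filter; map; foldr; allFin; applyUpTo)
open import Data.List.Properties using (length-map; length-applyUpTo)
open import Data.List.Relation.Unary.Any using (here; there)
open import Data.List.Membership.Propositional.Properties
  using (∉[]; ∈-allFin; ∈-filter⁺; ∈-map⁺; ∈-applyUpTo⁺)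
open import Data.Nat
open import Data.Nat.Properties
open import Data.List.Membership.DecPropositional _≟_ using (_∈_; _∈?_)
open import Data.Product using (Σ; ∃; _×_; _,_; proj₁; proj₂)
open import Data.Sum using (_⊎_; inj₁; inj₂; [_,_])
open import Function using (_∘_)
open import Function.Bundles using (_⇔_; mk⇔; Equivalence)
open import Relation.Binary.Definitions using (tri<; tri≈; tri>)
open import Relation.Binary.PropositionalEquality hiding ([_])
open import Relation.Nullary using (¬_; yes; no; _×-dec_)
open import Relation.Nullary.Decidable using (T?)
open import Relation.Unary using (Decidable)

module _ {P : ℕ → Set} (P? : Decidable P) where

  rank : ℕ → ℕ
  rank zero = 0
  rank (suc k) with P? k
  ... | yes _ = suc (rank k)
  ... | no  _ = rank k

  rank-step : ∀ k → rank k ≤ rank (suc k)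
  rank-step k with P? k
  ... | yes _ = n≤1+n _
  ... | no  _ = ≤-refl

  rank-mono : ∀ {k k′} → k ≤ k′ → rank k ≤ rank k′
  rank-mono = mono′ ∘ ≤⇒≤′
    where
    mono′ : ∀ {k k′} → k ≤′ k′ → rank k ≤ rank k′
    mono′ ≤′-refl       = ≤-refl
    mono′ (≤′-step k≤k′) = ≤-trans (mono′ k≤k′) (rank-step _)

  rank-suc : ∀ {c} → P c → rank (suc c) ≡ suc (rank c)
  rank-suc {c} p with P? c
  ... | yes _ = refl
  ... | no ¬p = ⊥-elim (¬p p)

  rank-< : ∀ {c k} → P c → c < k → rank c < rank k
  rank-< p c<k = subst (_≤ _) (rank-suc p) (rank-mono c<k)

  rank-injective : ∀ {c c′} → P c → P c′ → rank c ≡ rank c′ → c ≡ c′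
  rank-injective {c} {c′} p p′ eq with <-cmp c c′
  ... | tri< c<c′ _ _ = ⊥-elim (<-irrefl eq (rank-< p c<c′))
  ... | tri≈ _ c≡c′ _ = c≡c′
  ... | tri> _ _ c′<c = ⊥-elim (<-irrefl (sym eq) (rank-< p′ c′<c))

  rank-surjective : ∀ {r} k → r < rank k → ∃ λ c → P c × rank c ≡ r
  rank-surjective (suc k) r<rank with P? k
  ... | no  _ = rank-surjective k r<rank
  ... | yes p with m≤n⇒m<n∨m≡n (≤-pred r<rank)
  ...   | inj₁ r<rank′ = rank-surjective k r<rank′
  ...   | inj₂ r≡rank  = k , p , sym r≡rank

  rank≡0 : ∀ k → (∀ c → c < k → ¬ P c) → rank k ≡ 0
  rank≡0 zero    _ = refl
  rank≡0 (suc k) ¬P with P? k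
  ... | yes p = ⊥-elim (¬P k ≤-refl p)
  ... | no  _ = rank≡0 k (λ c c<k → ¬P c (m≤n⇒m≤1+n c<k))

module _ {P Q : ℕ → Set} (P? : Decidable P) (Q? : Decidable Q) where

  rank-cong : (∀ c → P c ⇔ Q c) → ∀ k → rank P? k ≡ rank Q? k
  rank-cong P⇔Q zero = refl
  rank-cong P⇔Q (suc k) with P? k | Q? k
  ... | yes _ | yes _ = cong suc (rank-cong P⇔Q k)
  ... | no  _ | no  _ = rank-cong P⇔Q k
  ... | yes p | no ¬q = ⊥-elim (¬q (Equivalence.to (P⇔Q k) p))
  ... | no ¬p | yes q = ⊥-elim (¬p (Equivalence.from (P⇔Q k) q))

  rank-⊆-∪ : ∀ {R : ℕ → Set} (R? : Decidable R) → (∀ c → P c → Q c ⊎ R c) →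
    ∀ k → rank P? k ≤ rank Q? k + rank R? k
  rank-⊆-∪ R? P⊆Q∪R zero = z≤n
  rank-⊆-∪ R? P⊆Q∪R (suc k) with P? k
  ... | no _ = ≤-trans (rank-⊆-∪ R? P⊆Q∪R k) (+-mono-≤ (rank-step Q? k) (rank-step R? k))
  ... | yes p with Q? k | R? k
  ...   | yes _ | yes _ = s≤s (≤-trans (rank-⊆-∪ R? P⊆Q∪R k) (+-monoʳ-≤ _ (n≤1+n _)))
  ...   | yes _ | no  _ = s≤s (rank-⊆-∪ R? P⊆Q∪R k)
  ...   | no  _ | yes _ = ≤-trans (s≤s (rank-⊆-∪ R? P⊆Q∪R k)) (≤-reflexive (sym (+-suc _ _)))
  ...   | no ¬q | no ¬r = ⊥-elim ([ ¬q , ¬r ] (P⊆Q∪R k p))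

rank-≡-≤1 : ∀ a k → rank (_≟ a) k ≤ 1
rank-≡-≤1 a zero = z≤n
rank-≡-≤1 a (suc k) with k ≟ a
... | yes refl = s≤s (≤-reflexive (rank≡0 (_≟ a) k (λ c c<a c≡a → <-irrefl c≡a c<a)))
... | no  _    = rank-≡-≤1 a k

rank-≤-length : ∀ {P : ℕ → Set} (P? : Decidable P) (L : List ℕ) →
  (∀ c → P c → c ∈ L) → ∀ k → rank P? k ≤ length L
rank-≤-length P? [] P⊆[] k = ≤-reflexive (rank≡0 P? k (λ c _ p → ∉[] (P⊆[] c p)))
rank-≤-length {P} P? (a ∷ L) P⊆a∷L k = begin
  rank P? k                         ≤⟨ rank-⊆-∪ P? (_≟ a) (_∈? L) split k ⟩
  rank (_≟ a) k + rank (_∈? L) k    ≤⟨ +-mono-≤ (rank-≡-≤1 a k) (rank-≤-length (_∈? L) L (λ _ c∈L → c∈L) k) ⟩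
  suc (length L)                    ∎
  where
  open ≤-Reasoning
  split : ∀ c → P c → c ≡ a ⊎ c ∈ L
  split c p with P⊆a∷L c p
  ... | here c≡a  = inj₁ c≡a
  ... | there c∈L = inj₂ c∈L

≤-foldr-⊔ : ∀ {a L} → a ∈ L → a ≤ foldr _⊔_ 0 L
≤-foldr-⊔ (here refl)          = m≤m⊔n _ _
≤-foldr-⊔ {L = b ∷ _} (there p) = ≤-trans (≤-foldr-⊔ p) (m≤n⊔m b _)

≤-foldr-⊔-allFin : ∀ {k} (f : Fin k → ℕ) i → f i ≤ foldr _⊔_ 0 (map f (allFin k))
≤-foldr-⊔-allFin f i = ≤-foldr-⊔ (∈-map⁺ f (∈-allFin i))

m*n+o<m*p : ∀ m {n o p} → o < m → n < p → m * n + o < m * p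
m*n+o<m*p m {n} {o} {p} o<m n<p = begin-strict
  m * n + o  <⟨ +-monoʳ-< (m * n) o<m ⟩
  m * n + m  ≡⟨ +-comm (m * n) m ⟩
  m + m * n  ≡⟨ *-suc m n ⟨
  m * suc n  ≤⟨ *-monoʳ-≤ m n<p ⟩
  m * p      ∎
  where open ≤-Reasoning

m*n+o≡m*p+q⇒n≡p×o≡q : ∀ m {n o p q} → o < m → q < m → m * n + o ≡ m * p + q → n ≡ p × o ≡ q
m*n+o≡m*p+q⇒n≡p×o≡q m {n} {o} {p} {q} o<m q<m eq with <-cmp n p
... | tri≈ _ refl _ = refl , +-cancelˡ-≡ (m * n) o q eq
... | tri< n<p _ _ = ⊥-elim (<-irrefl eq (<-≤-trans (m*n+o<m*p m o<m n<p) (m≤m+n (m * p) q)))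
... | tri> _ _ p<n = ⊥-elim (<-irrefl (sym eq) (<-≤-trans (m*n+o<m*p m q<m p<n) (m≤m+n (m * n) o)))

module _ (G : BipGraph) (col : Colouring G) where

  palette? : ∀ x → Decidable (InPalette G col (inj₁ x))
  palette? x c = Fin.any? λ y → (adj G x y Bool.≟ true) ×-dec (col x y ≟ c)

  paletteRank : Fin (m G) → ℕ → ℕ
  paletteRank x = rank (palette? x)

  paletteSize : Fin (m G) → ℕ
  paletteSize x = paletteRank x (suc (foldr _⊔_ 0 (map (col x) (allFin (n G)))))

  paletteRank<paletteSize : ∀ {x y} → adj G x y ≡ true → paletteRank x (col x y) < paletteSize x
  paletteRank<paletteSize {x} {y} xy∈E =
    rank-< (palette? x) (y , xy∈E , refl) (s≤s (≤-foldr-⊔-allFin (col x) y))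

  paletteSize≤degX : ∀ x → paletteSize x ≤ degX G x
  paletteSize≤degX x = ≤-trans
    (rank-≤-length (palette? x) (map (col x) neighbours) inPalette⇒∈ _)
    (≤-reflexive (length-map (col x) neighbours))
    where
    neighbours = filter (λ y → T? (adj G x y)) (allFin (n G))
    inPalette⇒∈ : ∀ c → InPalette G col (inj₁ x) c → c ∈ map (col x) neighbours
    inPalette⇒∈ c (y , xy∈E , refl) =
      ∈-map⁺ (col x) (∈-filter⁺ (λ y → T? (adj G x y)) (∈-allFin y) (subst T (sym xy∈E) _))

  paletteRank<ΔX : ∀ {x y} → adj G x y ≡ true → paletteRank x (col x y) < ΔX G
  paletteRank<ΔX {x} xy∈E =
    <-≤-trans (paletteRank<paletteSize xy∈E) (≤-trans (paletteSize≤degX x) (≤-foldr-⊔-allFin (degX G) x))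

  module _ {s} (lab : Fin (m G) → Fin s) where

    -- The shift by one lets the empty palette of an isolated x be the empty
    -- interval [Δ·i + 1, Δ·i].
    stacked : Colouring G
    stacked x y = suc (ΔX G * toℕ (lab x) + paletteRank x (col x y))

    stacked-proper : Proper G col →
      (∀ x x′ → lab x ≡ lab x′ → SamePalette G col (inj₁ x) (inj₁ x′)) → Proper G stacked
    stacked-proper (properX , properY) lab-palette = stackedX , stackedY
      where
      stackedX : ∀ x y y′ → adj G x y ≡ true → adj G x y′ ≡ true → stacked x y ≡ stacked x y′ → y ≡ y′
      stackedX x y y′ xy∈E xy′∈E eq = properX x y y′ xy∈E xy′∈E
        (rank-injective (palette? x) (y , xy∈E , refl) (y′ , xy′∈E , refl)
          (+-cancelˡ-≡ (ΔX G * toℕ (lab x)) _ _ (suc-injective eq)))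

      stackedY : ∀ x x′ y → adj G x y ≡ true → adj G x′ y ≡ true → stacked x y ≡ stacked x′ y → x ≡ x′
      stackedY x x′ y xy∈E x′y∈E eq = properY x x′ y xy∈E x′y∈E
        (rank-injective (palette? x) (y , xy∈E , refl) x′y-colour∈palette-x ranks-agree)
        where
        labels-and-ranks = m*n+o≡m*p+q⇒n≡p×o≡q (ΔX G)
          (paletteRank<ΔX xy∈E) (paletteRank<ΔX x′y∈E) (suc-injective eq)
        same-palette : SamePalette G col (inj₁ x) (inj₁ x′)
        same-palette = lab-palette x x′ (Fin.toℕ-injective (proj₁ labels-and-ranks))
        x′y-colour∈palette-x : InPalette G col (inj₁ x) (col x′ y)
        x′y-colour∈palette-x = Equivalence.from (same-palette (col x′ y)) (y , x′y∈E , refl)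
        ranks-agree : paletteRank x (col x y) ≡ paletteRank x (col x′ y)
        ranks-agree = begin
          paletteRank x (col x y)    ≡⟨ proj₂ labels-and-ranks ⟩
          paletteRank x′ (col x′ y)  ≡⟨ rank-cong (palette? x) (palette? x′) same-palette (col x′ y) ⟨
          paletteRank x (col x′ y)   ∎
          where open ≡-Reasoning

    stacked-interval : XInterval G stacked
    stacked-interval x = suc base , base + paletteSize x , λ c → mk⇔ (to c) (from c)
      where
      base = ΔX G * toℕ (lab x)
      to : ∀ c → InPalette G stacked (inj₁ x) c → suc base ≤ c × c ≤ base + paletteSize x
      to c (y , xy∈E , refl) = s≤s (m≤m+n base _) ,
        ≤-trans (≤-reflexive (sym (+-suc base _))) (+-monoʳ-≤ base (paletteRank<paletteSize xy∈E))
      from : ∀ c → suc base ≤ c × c ≤ base + paletteSize x → InPalette G stacked (inj₁ x) c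
      from (suc c) (s≤s base≤c , c<base+size) with m≤n⇒∃[o]m+o≡n base≤c
      ... | r , refl with rank-surjective (palette? x) _ r<size
        where
        r<size : r < paletteSize x
        r<size = +-cancelˡ-≤ base (suc r) (paletteSize x) (≤-trans (≤-reflexive (+-suc base r)) c<base+size)
      ... | _ , (y , xy∈E , refl) , rank≡r = y , xy∈E , cong (λ r → suc (base + r)) rank≡r

    stacked-colours : AtMostColours G stacked (ΔX G * s)
    stacked-colours = applyUpTo suc (ΔX G * s) ,
      ≤-reflexive (length-applyUpTo suc (ΔX G * s)) ,
      λ x y xy∈E → ∈-applyUpTo⁺ suc (m*n+o<m*p (ΔX G) (paletteRank<ΔX xy∈E) (Fin.toℕ<n (lab x)))

proposition3p1 : (G : BipGraph) (s : ℕ) → IsPaletteIndex G s →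
    Σ (Colouring G) λ col → Proper G col × XInterval G col × AtMostColours G col (ΔX G * s)
proposition3p1 G s ((col , proper , lab , lab-palette) , _) =
  stacked G col labX ,
  stacked-proper G col labX proper (λ x x′ → lab-palette (inj₁ x) (inj₁ x′)) ,
  stacked-interval G col labX ,
  stacked-colours G col labX
  where
  labX = lab ∘ inj₁
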